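{- Let $\mathbf{ILX}$ be a logic extending $\mathbf{IL}$ that contains every instance of $\mathsf M_0$: $A\rhd B\to\Diamond A\wedge\Box C\rhd B\wedge\Box C$. For $\mathbf{ILX}$-MCSs $\Gamma,\Delta,\Delta'$ and a set of formulas $S$: if $\Gamma\prec_S\Delta\prec\Delta'$ then $\Gamma\prec_{S\cup\Delta^{\Box}_{\emptyset}}\Delta'$, where $\Delta^{\Box}_{\emptyset}=\{\Box C:\Box C\in\Delta\}$.
   Context: Formulas: $\bot$, propositional variables, $\to$, $\Box$, binary $\rhd$; $\Diamond A:=\neg\Box\neg A$. $\mathbf{IL}$: classical tautologies, K, L: $\Box(\Box A\to A)\to\Box A$, J1: $\Box(A\to B)\to A\rhd B$, J2: $(A\rhd B)\wedge(B\rhd C)\to A\rhd C$, J3: $(A\rhd C)\wedge(B\rhd C)\to A\vee B\rhd C$, J4: $A\rhd B\to(\Diamond A\to\Diamond B)$, J5: $\Diamond A\rhd A$; rules modus ponens and necessitation. An $\mathbf{ILX}$-MCS is a maximal $\mathbf{ILX}$-consistent set. $\Gamma\prec\Delta$ iff $\Box A\in\Gamma$ implies $A,\Box A\in\Delta$. $\Gamma\prec_S\Delta$ iff for every formula $A$ and finite $S'\subseteq S$, $\neg A\rhd\bigvee_{\sigma\in S'}\neg\sigma\in\Gamma$ implies $A,\Box A\in\Delta$ (empty disjunction is $\bot$). -}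

module Defs where

open import Data.Nat using (ℕ)
open import Data.Bool using (Bool; true; false; not; _∨_)
open import Data.List using (List; []; _∷_; map)
open import Data.List.Relation.Unary.All using (All)
open import Data.Product using (Σ; _×_)
open import Level using (0ℓ)
open import Relation.Unary using (Pred; _∈_; _∪_; _⊆_)
open import Relation.Binary.PropositionalEquality using (_≡_)
open import Relation.Nullary using (¬_)

infixr 6 _⇒_
infix 7 _▷_
infix 8 □_

data Formula : Set where
  ⊥'  : Formula
  var : ℕ → Formula
  _⇒_ : Formula → Formula → Formula
  □_  : Formula → Formula
  _▷_ : Formula → Formula → Formula

~_ : Formula → Formula
~ A = A ⇒ ⊥'

⊤' : Formula
⊤' = ~ ⊥'

_∨'_ : Formula → Formula → Formula
A ∨' B = (~ A) ⇒ B

_∧'_ : Formula → Formula → Formula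
A ∧' B = ~ (A ⇒ ~ B)

◇_ : Formula → Formula
◇ A = ~ (□ (~ A))

⋁ : List Formula → Formula
⋁ []       = ⊥'
⋁ (A ∷ As) = A ∨' ⋁ As

⋀ : List Formula → Formula
⋀ []       = ⊤'
⋀ (A ∷ As) = A ∧' ⋀ As

-- Classical (propositional) tautologies: true under every Boolean valuation
-- of the propositional atoms (variables, □-formulas, ▷-formulas).
eval : (Formula → Bool) → Formula → Bool
eval v ⊥'        = false
eval v (var p)   = v (var p)
eval v (A ⇒ B)   = not (eval v A) ∨ eval v B
eval v (□ A)     = v (□ A)
eval v (A ▷ B)   = v (A ▷ B)

Tautology : Formula → Set
Tautology A = (v : Formula → Bool) → eval v A ≡ true

data _⊢_ (X : Pred Formula 0ℓ) : Formula → Set where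
  taut : ∀ {A} → Tautology A → X ⊢ A
  axK  : ∀ {A B} → X ⊢ (□ (A ⇒ B) ⇒ (□ A ⇒ □ B))
  axL  : ∀ {A} → X ⊢ (□ (□ A ⇒ A) ⇒ □ A)
  axJ1 : ∀ {A B} → X ⊢ (□ (A ⇒ B) ⇒ A ▷ B)
  axJ2 : ∀ {A B C} → X ⊢ (((A ▷ B) ∧' (B ▷ C)) ⇒ A ▷ C)
  axJ3 : ∀ {A B C} → X ⊢ (((A ▷ C) ∧' (B ▷ C)) ⇒ (A ∨' B) ▷ C)
  axJ4 : ∀ {A B} → X ⊢ ((A ▷ B) ⇒ (◇ A ⇒ ◇ B))
  axJ5 : ∀ {A} → X ⊢ ((◇ A) ▷ A)
  axX  : ∀ {A} → A ∈ X → X ⊢ A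
  mp   : ∀ {A B} → X ⊢ (A ⇒ B) → X ⊢ A → X ⊢ B
  nec  : ∀ {A} → X ⊢ A → X ⊢ (□ A)

M₀ : Formula → Formula → Formula → Formula
M₀ A B C = (A ▷ B) ⇒ (((◇ A) ∧' (□ C)) ▷ (B ∧' (□ C)))

FSet : Set₁
FSet = Pred Formula 0ℓ

Consistent : Pred Formula 0ℓ → FSet → Set
Consistent X Γ = (L : List Formula) → All (_∈ Γ) L → ¬ (X ⊢ (⋀ L ⇒ ⊥'))

MCS : Pred Formula 0ℓ → FSet → Set₁
MCS X Γ = Consistent X Γ × ((Δ : FSet) → Γ ⊆ Δ → Consistent X Δ → Δ ⊆ Γ)

_≺_ : FSet → FSet → Set
Γ ≺ Δ = ∀ A → (□ A) ∈ Γ → (A ∈ Δ × (□ A) ∈ Δ)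

_≺[_]_ : FSet → FSet → FSet → Set
Γ ≺[ S ] Δ = ∀ A (S' : List Formula) → All (_∈ S) S' →
             ((~ A) ▷ ⋁ (map ~_ S')) ∈ Γ → (A ∈ Δ × (□ A) ∈ Δ)

BoxPart : FSet → FSet
BoxPart Δ φ = Σ Formula (λ C → (φ ≡ □ C) × ((□ C) ∈ Δ))

module Submission where

-- Let ¬A ▷ ⋁¬S' ∈ Γ with S' ⊆ S ∪ Δ^□_∅. Split S' into a part S'' ⊆ S
-- and formulas □C₁, …, □Cₙ ∈ Δ, and put E = C₁ ∧ … ∧ Cₙ, so □E ∈ Δ. Since
-- ⋁¬S' ∧ □E propositionally implies ⋁¬S'', M₀ together with J1 and J2 turns
-- the given formula into (◇¬A ∧ □E) ▷ ⋁¬S'' ∈ Γ. Now Γ ≺_S Δ yields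
-- ¬(◇¬A ∧ □E) ∈ Δ, which with □E ∈ Δ gives □A ∈ Δ, and Δ ≺ Δ' gives A, □A ∈ Δ'.

open import Defs
open import Relation.Unary using (Pred; _∪_; _∈_; ｛_｝)
open import Level using (0ℓ)
open import Data.Bool using (Bool; true; false; not; _∨_; T)
open import Data.Bool.Properties using (T?; T-≡)
open import Function using (Equivalence)
open import Data.Unit using (tt)
open import Data.List using (List; []; _∷_; map; _++_)
open import Data.List.Relation.Unary.All using (All; []; _∷_)
open import Data.List.Relation.Unary.All.Properties using (++⁺; ++⁻)
open import Data.Sum using (_⊎_; inj₁; inj₂)
open import Data.Product using (Σ-syntax; _×_; _,_; proj₁)
open import Data.Empty using (⊥-elim)
open import Relation.Nullary using (¬_; yes; no)
open import Relation.Binary.PropositionalEquality using (refl)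

-- (1) Truth of a formula under a valuation of the propositional atoms.
-- A record, so that the valuation and formula are inferable from the type.
record Holds (v : Formula → Bool) (A : Formula) : Set where
  constructor ⟨_⟩
  field holds : T (eval v A)
open Holds

module _ {v : Formula → Bool} where

  ⇒I : ∀ {A B} → (Holds v A → Holds v B) → Holds v (A ⇒ B)
  ⇒I {A} {B} f = ⟨ intro (eval v A) (eval v B) (λ a → holds (f ⟨ a ⟩)) ⟩
    where
    intro : ∀ a b → (T a → T b) → T (not a ∨ b)
    intro true  _ g = g tt
    intro false _ _ = tt

  ⇒E : ∀ {A B} → Holds v (A ⇒ B) → Holds v A → Holds v B
  ⇒E {A} {B} ⟨ h ⟩ ⟨ a ⟩ = ⟨ elim (eval v A) (eval v B) h a ⟩
    where
    elim : ∀ a b → T (not a ∨ b) → T a → T b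
    elim true _ h _ = h

  ~I : ∀ {A} → ¬ Holds v A → Holds v (~ A)
  ~I f = ⇒I (λ a → ⊥-elim (f a))

  ~E : ∀ {A} → Holds v (~ A) → ¬ Holds v A
  ~E h a = holds (⇒E h a)

  byCases : ∀ {A} {R : Set} → (Holds v A → R) → (¬ Holds v A → R) → R
  byCases {A} yes-case no-case with T? (eval v A)
  ... | yes a = yes-case ⟨ a ⟩
  ... | no ¬a = no-case (λ a → ¬a (holds a))

  ∧I : ∀ {A B} → Holds v A → Holds v B → Holds v (A ∧' B)
  ∧I a b = ~I (λ h → ~E (⇒E h a) b)

  ∧E : ∀ {A B} → Holds v (A ∧' B) → Holds v A × Holds v B
  ∧E h = byCases (λ a → a , byCases (λ b → b) (λ ¬b → ⊥-elim (~E h (⇒I (λ _ → ~I ¬b)))))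
                 (λ ¬a → ⊥-elim (~E h (⇒I (λ a → ⊥-elim (¬a a)))))

  ∨I₁ : ∀ {A B} → Holds v A → Holds v (A ∨' B)
  ∨I₁ a = ⇒I (λ ¬a → ⊥-elim (~E ¬a a))

  ∨I₂ : ∀ {A B} → Holds v B → Holds v (A ∨' B)
  ∨I₂ b = ⇒I (λ _ → b)

  ∨E : ∀ {A B} → Holds v (A ∨' B) → Holds v A ⊎ Holds v B
  ∨E h = byCases inj₁ (λ ¬a → inj₂ (⇒E h (~I ¬a)))

  ⋀I : ∀ {L} → All (Holds v) L → Holds v (⋀ L)
  ⋀I []       = ~I holds
  ⋀I (a ∷ as) = ∧I a (⋀I as)

  ⋀E : ∀ {L} → Holds v (⋀ L) → All (Holds v) L
  ⋀E {[]}    _ = []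
  ⋀E {_ ∷ _} h = let a , as = ∧E h in a ∷ ⋀E as

infix 4 _⇛_

_⇛_ : List Formula → Formula → Formula
[]       ⇛ Q = Q
(P ∷ Ps) ⇛ Q = P ⇒ (Ps ⇛ Q)

module _ {v : Formula → Bool} where

  ⇛I : ∀ {Ps Q} → (All (Holds v) Ps → Holds v Q) → Holds v (Ps ⇛ Q)
  ⇛I {[]}    f = f []
  ⇛I {_ ∷ _} f = ⇒I (λ p → ⇛I (λ ps → f (p ∷ ps)))

  ⇛E : ∀ {Ps Q} → Holds v (Ps ⇛ Q) → All (Holds v) Ps → Holds v Q
  ⇛E h []       = h
  ⇛E h (p ∷ ps) = ⇛E (⇒E h p) ps

module _ {X : Pred Formula 0ℓ} where

  infer : ∀ {Ps Q} → All (X ⊢_) Ps → (∀ v → All (Holds v) Ps → Holds v Q) → X ⊢ Q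
  infer {Q = Q} ⊢Ps sem = discharge ⊢Ps (taut (λ v → Equivalence.to T-≡ (holds (⇛I (sem v)))))
    where
    discharge : ∀ {Rs} → All (X ⊢_) Rs → X ⊢ (Rs ⇛ Q) → X ⊢ Q
    discharge []         d = d
    discharge (⊢R ∷ ⊢Rs) d = discharge ⊢Rs (mp d ⊢R)

  □-mono : ∀ {A B} → X ⊢ (A ⇒ B) → X ⊢ (□ A ⇒ □ B)
  □-mono d = mp axK (nec d)

  □-mono₂ : ∀ {A B C} → X ⊢ (A ⇒ (B ⇒ C)) → X ⊢ (□ A ⇒ (□ B ⇒ □ C))
  □-mono₂ {B = B} {C} d = infer (□-mono d ∷ axK {A = B} {C} ∷ [])
    λ { v (mono ∷ k ∷ []) → ⇒I (λ a → ⇒E k (⇒E mono a)) }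

  □-⋀-intro : ∀ Cs → X ⊢ (map □_ Cs ⇛ □ (⋀ Cs))
  □-⋀-intro []       = nec (infer [] (λ v _ → ~I holds))
  □-⋀-intro (C ∷ Cs) = infer (□-⋀-intro Cs ∷ □-mono₂ (infer [] (λ v _ → ⇒I (λ c → ⇒I (∧I c)))) ∷ [])
    λ { v (ih ∷ pair ∷ []) → ⇒I (λ c → ⇛I (λ cs → ⇒E (⇒E pair c) (⇛E ih cs))) }

  □-⋀-elim : ∀ Cs → X ⊢ (□ (⋀ Cs) ⇒ ⋀ (map □_ Cs))
  □-⋀-elim []       = infer [] (λ v _ → ⇒I (λ _ → ~I holds))
  □-⋀-elim (C ∷ Cs) = infer (□-mono (infer [] (λ v _ → ⇒I (λ h → proj₁ (∧E h))))
                           ∷ □-mono (infer [] (λ v _ → ⇒I (λ h → let _ , cs = ∧E h in cs)))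
                           ∷ □-⋀-elim Cs ∷ [])
    λ { v (first ∷ rest ∷ ih ∷ []) → ⇒I (λ h → ∧I (⇒E first h) (⇒E ih (⇒E rest h))) }

  M₀-weaken : (∀ A B C → X ⊢ M₀ A B C) → ∀ {A D E B} →
              X ⊢ ((D ∧' (□ E)) ⇒ B) → X ⊢ ((A ▷ D) ⇒ (((◇ A) ∧' (□ E)) ▷ B))
  M₀-weaken m₀ {A} {D} {E} {B} d =
    infer (m₀ A D E ∷ mp axJ1 (nec d) ∷ axJ2 {A = (◇ A) ∧' (□ E)} {D ∧' (□ E)} {B} ∷ [])
      λ { v (m ∷ j₁ ∷ j₂ ∷ []) → ⇒I (λ h → ⇒E j₂ (∧I (⇒E m h) j₁)) }

  □-from-¬◇¬ : ∀ {A E} → X ⊢ (((◇ (~ A)) ⇒ ~ (□ E)) ∷ □ E ∷ [] ⇛ □ A)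
  □-from-¬◇¬ {A} = infer (□-mono {~ (~ A)} {A} (infer [] (λ v _ → ⇒I dne)) ∷ [])
    λ { v (□dne ∷ []) → ⇒I (λ h → ⇒I (λ □e →
          byCases (⇒E □dne) (λ ¬□¬¬a → ⊥-elim (~E (⇒E h (~I ¬□¬¬a)) □e)))) }
    where
    dne : ∀ {v} → Holds v (~ (~ A)) → Holds v A
    dne ¬¬a = byCases (λ a → a) (λ ¬a → ⊥-elim (~E ¬¬a (~I ¬a)))

  -- (3) A maximal consistent set is closed under ILX-derivation from
  -- finitely many of its members: otherwise Δ ∪ {Q} would be a consistent
  -- proper extension.
  closed : ∀ {Δ Q} → MCS X Δ → (L : List Formula) → All (_∈ Δ) L → X ⊢ (L ⇛ Q) → Q ∈ Δ
  closed {Δ} {Q} (consistent , maximal) L L⊆Δ ⊢L⇛Q =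
    maximal (Δ ∪ ｛ Q ｝) inj₁ extension-consistent (inj₂ refl)
    where
    withoutQ : (K : List Formula) → All (_∈ Δ ∪ ｛ Q ｝) K →
               Σ[ K' ∈ List Formula ] All (_∈ Δ) K' ×
               (∀ {v} → Holds v Q → All (Holds v) K' → All (Holds v) K)
    withoutQ []      []              = [] , [] , λ _ _ → []
    withoutQ (φ ∷ K) (inj₁ φ∈Δ ∷ K⊆) =
      let K' , K'⊆Δ , restore = withoutQ K K⊆
      in φ ∷ K' , φ∈Δ ∷ K'⊆Δ , λ { q (f ∷ fs) → f ∷ restore q fs }
    withoutQ (φ ∷ K) (inj₂ refl ∷ K⊆) =
      let K' , K'⊆Δ , restore = withoutQ K K⊆
      in K' , K'⊆Δ , λ q fs → q ∷ restore q fs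

    extension-consistent : Consistent X (Δ ∪ ｛ Q ｝)
    extension-consistent K K⊆ ⊢¬K =
      let K' , K'⊆Δ , restore = withoutQ K K⊆
      in consistent (K' ++ L) (++⁺ K'⊆Δ L⊆Δ) (infer (⊢L⇛Q ∷ ⊢¬K ∷ [])
           λ { v (l⇛q ∷ ¬k ∷ []) → ⇒I (λ h →
                 let k' , l = ++⁻ K' (⋀E h)
                 in ⇒E ¬k (⋀I (restore (⇛E l⇛q l) k'))) })

record Split (S Δ : FSet) (S' : List Formula) : Set where
  field
    inS       : List Formula
    inS⊆S     : All (_∈ S) inS
    boxed     : List Formula
    □boxed⊆Δ  : All (_∈ Δ) (map □_ boxed)
    reduction : ∀ {v} → Holds v (⋁ (map ~_ S')) → All (Holds v) (map □_ boxed) →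
                Holds v (⋁ (map ~_ inS))

split : ∀ {S Δ} (S' : List Formula) → All (_∈ S ∪ BoxPart Δ) S' → Split S Δ S'
split [] [] = record
  { inS = [] ; inS⊆S = [] ; boxed = [] ; □boxed⊆Δ = [] ; reduction = λ h _ → h }
split {S} {Δ} (σ ∷ S') (inj₁ σ∈S ∷ S'⊆) = record
  { inS = σ ∷ inS ; inS⊆S = σ∈S ∷ inS⊆S ; boxed = boxed ; □boxed⊆Δ = □boxed⊆Δ
  ; reduction = λ h □s → case∨ (∨E h) □s }
  where
  open Split (split {S} {Δ} S' S'⊆)
  case∨ : ∀ {v} → Holds v (~ σ) ⊎ Holds v (⋁ (map ~_ S')) → All (Holds v) (map □_ boxed) →
          Holds v (⋁ (map ~_ (σ ∷ inS)))
  case∨ (inj₁ ¬σ)   _  = ∨I₁ ¬σ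
  case∨ (inj₂ rest) □s = ∨I₂ (reduction rest □s)
split {S} {Δ} (.(□ C) ∷ S') (inj₂ (C , refl , □C∈Δ) ∷ S'⊆) = record
  { inS = inS ; inS⊆S = inS⊆S ; boxed = C ∷ boxed ; □boxed⊆Δ = □C∈Δ ∷ □boxed⊆Δ
  ; reduction = λ h → case∨ (∨E h) }
  where
  open Split (split {S} {Δ} S' S'⊆)
  case∨ : ∀ {v} → Holds v (~ (□ C)) ⊎ Holds v (⋁ (map ~_ S')) →
          All (Holds v) (map □_ (C ∷ boxed)) → Holds v (⋁ (map ~_ inS))
  case∨ (inj₁ ¬□C)  (□c ∷ _)  = ⊥-elim (~E ¬□C □c)
  case∨ (inj₂ rest) (_ ∷ □s) = reduction rest □s

split-derivation : ∀ {X S Δ S'} (sp : Split S Δ S') → let open Split sp in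
                   X ⊢ ((⋁ (map ~_ S') ∧' (□ (⋀ boxed))) ⇒ ⋁ (map ~_ inS))
split-derivation sp = infer (□-⋀-elim boxed ∷ [])
  λ { v (elim ∷ []) → ⇒I (λ h → let d , □e = ∧E h in reduction d (⋀E (⇒E elim □e))) }
  where open Split sp

-- (5) Γ ≺_S Δ forces □A into Δ as soon as (◇¬A ∧ □E) ▷ ⋁¬S'' ∈ Γ for some
-- finite S'' ⊆ S and □E ∈ Δ: the antecedent is ¬F for F = ◇¬A → ¬□E, so
-- F ∈ Δ, and F, □E ⊢ □A.
□-from-≺S : ∀ {X Γ Δ S A E} (S'' : List Formula) → MCS X Δ → Γ ≺[ S ] Δ →
            All (_∈ S) S'' → (((◇ (~ A)) ∧' (□ E)) ▷ ⋁ (map ~_ S'')) ∈ Γ → (□ E) ∈ Δ →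
            (□ A) ∈ Δ
□-from-≺S {Δ = Δ} {A = A} {E} S'' mΔ Γ≺Δ S''⊆S ▷∈Γ □E∈Δ =
  closed mΔ (_ ∷ □ E ∷ []) (F∈Δ ∷ □E∈Δ ∷ []) □-from-¬◇¬
  where
  F∈Δ : ((◇ (~ A)) ⇒ ~ (□ E)) ∈ Δ
  F∈Δ = proj₁ (Γ≺Δ ((◇ (~ A)) ⇒ ~ (□ E)) S'' S''⊆S ▷∈Γ)

lemma6p4 : (X : Pred Formula 0ℓ) → (∀ A B C → X ⊢ M₀ A B C) → (Γ Δ Δ' S : FSet) → MCS X Γ → MCS X Δ → MCS X Δ' → Γ ≺[ S ] Δ → Δ ≺ Δ' → Γ ≺[ S ∪ BoxPart Δ ] Δ'
lemma6p4 _ m₀ Γ Δ _ S mΓ mΔ _ Γ≺Δ Δ≺Δ' A S' S'⊆ ▷∈Γ = Δ≺Δ' A □A∈Δ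
  where
  sp : Split S Δ S'
  sp = split S' S'⊆
  open Split sp

  □E∈Δ : (□ (⋀ boxed)) ∈ Δ
  □E∈Δ = closed mΔ (map □_ boxed) □boxed⊆Δ (□-⋀-intro boxed)

  strengthened∈Γ : (((◇ (~ A)) ∧' (□ (⋀ boxed))) ▷ ⋁ (map ~_ inS)) ∈ Γ
  strengthened∈Γ = closed mΓ ((~ A) ▷ ⋁ (map ~_ S') ∷ []) (▷∈Γ ∷ []) (M₀-weaken m₀ (split-derivation sp))

  □A∈Δ : (□ A) ∈ Δ
  □A∈Δ = □-from-≺S {Γ = Γ} inS mΔ Γ≺Δ inS⊆S strengthened∈Γ □E∈Δ
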